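{- Let $a,b,c,d$ be real numbers with $a+b=c+d$, let $n\ge 1$, and let $k_1,\dots,k_n$ be real numbers. Define finite sequences $x^{(m)}=(x^{(m)}_1,\dots,x^{(m)}_{2^m})$ and $y^{(m)}=(y^{(m)}_1,\dots,y^{(m)}_{2^m})$ for $1\le m\le n$ recursively by $x^{(1)}=(a+k_1,\;b+k_1)$, $y^{(1)}=(c+k_1,\;d+k_1)$, and for $2\le m\le n$ and $1\le j\le 2^{m-1}$: $x^{(m)}_j=x^{(m-1)}_j$, $x^{(m)}_{2^{m-1}+j}=y^{(m-1)}_j+k_m$, $y^{(m)}_j=y^{(m-1)}_j$, $y^{(m)}_{2^{m-1}+j}=x^{(m-1)}_j+k_m$. Suppose there exists an index $i$ with $1<i\le n$ and $k_i=0$. Then for every $m$ with $i\le m\le n$ and every index $1\le r\le 2^m$ there exists an index $1\le q\le 2^m$ such that $x^{(m)}_r=y^{(m)}_q$.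
   Context: All numbers are real. -}

module Defs where

open import Level using (Level)
open import Algebra.Bundles using (CommutativeRing)
open import Data.Nat using (ℕ; zero; suc; _^_)
open import Data.Nat.Properties using (+-identityʳ)
open import Data.Fin using (Fin; zero; suc; toℕ; inject₁)
open import Data.Vec using (Vec; []; _∷_; _++_; map; cast)
open import Data.Product using (_×_; _,_)
open import Relation.Binary.PropositionalEquality using (cong) renaming (sym to ≡-sym)

module Sequences {c ℓ : Level} (R : CommutativeRing c ℓ) where
  open CommutativeRing R using (_+_) renaming (Carrier to C)

  -- 2 ^ suc (suc m) reduces to 2 ^ suc m + (2 ^ suc m + 0)
  double : ∀ {p} → Vec C p → Vec C p → Vec C (p Data.Nat.+ (p Data.Nat.+ 0))
  double {p} u v = cast (cong (p Data.Nat.+_) (≡-sym (+-identityʳ p))) (u ++ v)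

  -- level a b c d k j  =  (x^(j+1) , y^(j+1))  (0-based Fin index j ↔ paper's m = j+1),
  -- built from k₁,…,k_n given as  k : Fin n → C  (k zero = k₁).
  -- Vector positions are 0-based: paper's index r corresponds to Fin position r-1.
  level : ∀ {n} (a b c' d : C) → (Fin n → C) → (j : Fin n) →
          Vec C (2 ^ suc (toℕ j)) × Vec C (2 ^ suc (toℕ j))
  level a b c' d k zero =
    (a + k zero ∷ b + k zero ∷ []) , (c' + k zero ∷ d + k zero ∷ [])
  level {suc n} a b c' d k (suc j) with level a b c' d (λ t → k (inject₁ t)) j
  ... | x , y = double x (map (_+ k (suc j)) y) , double y (map (_+ k (suc j)) x)

{-# OPTIONS --safe #-}
-- Write x ⊆ y when every entry of x occurs among the entries of y.  A step of
-- the recursion sends (x , y) to (x ++ (y + k) , y ++ (x + k)), which preserves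
-- "x ⊆ y and y ⊆ x".  At the step m = i, where k_i = 0, the new pair is
-- (x ++ y , y ++ x), whose two halves have the same entries for any x and y;
-- the invariant then propagates to all later m.
module Submission where

open import Defs
open import Level using (Level)
open import Algebra.Bundles using (CommutativeRing)
open import Relation.Binary.Bundles using (Setoid)
open import Data.Nat using (ℕ; zero; suc; _^_; _≤_; _<_; z≤n; s≤s) renaming (_+_ to _+ℕ_)
open import Data.Nat.Properties using (m≤n⇒m<n∨m≡n)
open import Data.Fin using (Fin; toℕ; zero; suc; inject₁; _↑ˡ_; _↑ʳ_)
import Data.Fin as Fin
open import Data.Fin.Properties using (toℕ-injective; toℕ-inject₁)
open import Data.Vec using (Vec; []; _∷_; lookup; _++_; map; cast)
open import Data.Vec.Properties using (lookup-++ˡ; lookup-++ʳ; lookup-cast; lookup-cast₁; lookup-map)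
open import Data.Product using (∃; proj₁; proj₂; _×_; _,_)
open import Data.Sum using (inj₁; inj₂)
open import Function using (_∘_)
open import Relation.Binary.PropositionalEquality as ≡ using (_≡_)

module EntryInclusion {a ℓ : Level} (S : Setoid a ℓ) where
  open Setoid S renaming (Carrier to A)

  infix 4 _⊆_

  record _⊆_ {p q} (u : Vec A p) (v : Vec A q) : Set ℓ where
    constructor locatedBy
    field locate : ∀ r → ∃ λ q → lookup u r ≈ lookup v q

  open _⊆_ public

  SameEntries : ∀ {p q} → Vec A p → Vec A q → Set ℓ
  SameEntries u v = u ⊆ v × v ⊆ u

  ⊆-trans : ∀ {p q s} {u : Vec A p} {v : Vec A q} {w : Vec A s} → u ⊆ v → v ⊆ w → u ⊆ w
  ⊆-trans u⊆v v⊆w = locatedBy λ r →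
    let q , e = locate u⊆v r ; s , e′ = locate v⊆w q in s , trans e e′

  ⊆-++ˡ : ∀ {p q} (u : Vec A p) (v : Vec A q) → u ⊆ u ++ v
  ⊆-++ˡ u v = locatedBy λ r → r ↑ˡ _ , reflexive (≡.sym (lookup-++ˡ u v r))

  ⊆-++ʳ : ∀ {p q} (u : Vec A p) (v : Vec A q) → v ⊆ u ++ v
  ⊆-++ʳ u v = locatedBy λ r → _ ↑ʳ r , reflexive (≡.sym (lookup-++ʳ u v r))

  ++-⊆ : ∀ {p q s} {u : Vec A p} {v : Vec A q} {w : Vec A s} → u ⊆ w → v ⊆ w → u ++ v ⊆ w
  ++-⊆ {u = []}    u⊆w v⊆w = v⊆w
  ++-⊆ {u = _ ∷ u} u⊆w v⊆w = locatedBy λ where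
    zero    → locate u⊆w zero
    (suc r) → locate (++-⊆ {u = u} (locatedBy (locate u⊆w ∘ suc)) v⊆w) r

  ⊆-cast : ∀ {p q} .(eq : p ≡ q) (u : Vec A p) → u ⊆ cast eq u
  ⊆-cast eq u = locatedBy λ r → Fin.cast eq r , reflexive (≡.sym (lookup-cast eq u r))

  cast-⊆ : ∀ {p q} .(eq : p ≡ q) (u : Vec A p) → cast eq u ⊆ u
  cast-⊆ eq u = locatedBy λ r → Fin.cast (≡.sym eq) r , reflexive (lookup-cast₁ eq u r)

  ⊆-map : ∀ {p q} {f : A → A} → (∀ {x y} → x ≈ y → f x ≈ f y) →
          {u : Vec A p} {v : Vec A q} → u ⊆ v → map f u ⊆ map f v
  ⊆-map {f = f} f-cong {u} {v} u⊆v = locatedBy λ r →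
    let q , e = locate u⊆v r in
    q , trans (reflexive (lookup-map r f u)) (trans (f-cong e) (reflexive (≡.sym (lookup-map q f v))))

  sameEntries-map-id : ∀ {p} {f : A → A} → (∀ x → f x ≈ x) → (u : Vec A p) → SameEntries (map f u) u
  sameEntries-map-id {f = f} f≈id u =
    map⊆u , locatedBy λ r → let q , e = locate map⊆u r in q , sym e
    where
    map⊆u : map f u ⊆ u
    map⊆u = locatedBy λ r → r , trans (reflexive (lookup-map r f u)) (f≈id (lookup u r))

module LevelEntries {c ℓ : Level} (R : CommutativeRing c ℓ) where
  open CommutativeRing R renaming (Carrier to C)
  open Sequences R
  open EntryInclusion setoid

  ⊆-doubleˡ : ∀ {p} (u v : Vec C p) → u ⊆ double u v
  ⊆-doubleˡ u v = ⊆-trans (⊆-++ˡ u v) (⊆-cast _ (u ++ v))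

  ⊆-doubleʳ : ∀ {p} (u v : Vec C p) → v ⊆ double u v
  ⊆-doubleʳ u v = ⊆-trans (⊆-++ʳ u v) (⊆-cast _ (u ++ v))

  double-⊆ : ∀ {p q} {u v : Vec C p} {w : Vec C q} → u ⊆ w → v ⊆ w → double u v ⊆ w
  double-⊆ {u = u} {v} u⊆w v⊆w = ⊆-trans (cast-⊆ _ (u ++ v)) (++-⊆ u⊆w v⊆w)

  double-⊆-double : ∀ {p q} {u v : Vec C p} {u′ v′ : Vec C q} →
                    u ⊆ u′ → v ⊆ v′ → double u v ⊆ double u′ v′
  double-⊆-double {u′ = u′} {v′} u⊆u′ v⊆v′ =
    double-⊆ (⊆-trans u⊆u′ (⊆-doubleˡ u′ v′)) (⊆-trans v⊆v′ (⊆-doubleʳ u′ v′))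

  double-⊆-double-swap : ∀ {p q} {u v : Vec C p} {u′ v′ : Vec C q} →
                         u ⊆ v′ → v ⊆ u′ → double u v ⊆ double u′ v′
  double-⊆-double-swap {u′ = u′} {v′} u⊆v′ v⊆u′ =
    double-⊆ (⊆-trans u⊆v′ (⊆-doubleʳ u′ v′)) (⊆-trans v⊆u′ (⊆-doubleˡ u′ v′))

  -- level a b c′ d k (suc j) reduces definitionally to
  -- next (k (suc j)) (level a b c′ d (k ∘ inject₁) j).
  next : ∀ {p} → C → Vec C p × Vec C p → Vec C (p +ℕ (p +ℕ 0)) × Vec C (p +ℕ (p +ℕ 0))
  next κ (x , y) = double x (map (_+ κ) y) , double y (map (_+ κ) x)

  SameEntriesPair : ∀ {p} → Vec C p × Vec C p → Set ℓ
  SameEntriesPair (x , y) = SameEntries x y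

  sameEntries-next : ∀ {p} (κ : C) (xy : Vec C p × Vec C p) →
                     SameEntriesPair xy → SameEntriesPair (next κ xy)
  sameEntries-next κ _ (x⊆y , y⊆x) =
    double-⊆-double x⊆y (⊆-map +-cong-κ y⊆x) , double-⊆-double y⊆x (⊆-map +-cong-κ x⊆y)
    where
    +-cong-κ : ∀ {s t} → s ≈ t → s + κ ≈ t + κ
    +-cong-κ s≈t = +-cong s≈t refl

  sameEntries-next-zero : ∀ {p} {κ : C} → κ ≈ 0# →
                          (xy : Vec C p × Vec C p) → SameEntriesPair (next κ xy)
  sameEntries-next-zero {κ = κ} κ≈0 (x , y) =
    double-⊆-double-swap (proj₂ (+κ-id x)) (proj₁ (+κ-id y)) ,
    double-⊆-double-swap (proj₂ (+κ-id y)) (proj₁ (+κ-id x))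
    where
    +κ-id : ∀ {q} (u : Vec C q) → SameEntries (map (_+ κ) u) u
    +κ-id = sameEntries-map-id λ s → trans (+-congˡ κ≈0) (+-identityʳ s)

  -- k is indexed by Fin n but restricted along inject₁ at each level, so the
  -- vanishing index is tracked through its value in ℕ.
  sameEntries-level : ∀ (a b c′ d : C) {n} (k : Fin n → C) (i : ℕ) (m : Fin n) →
                      0 < i → i ≤ toℕ m → (∀ j → toℕ j ≡ i → k j ≈ 0#) →
                      SameEntriesPair (level a b c′ d k m)
  sameEntries-level a b c′ d k zero    m       ()
  sameEntries-level a b c′ d k (suc i) zero    _ ()
  sameEntries-level a b c′ d k (suc i) (suc m) _ i≤1+m kᵢ≈0 with m≤n⇒m<n∨m≡n i≤1+m
  ... | inj₂ i≡1+m =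
    sameEntries-next-zero (kᵢ≈0 (suc m) (≡.sym i≡1+m)) (level a b c′ d (k ∘ inject₁) m)
  ... | inj₁ (s≤s i≤m) = sameEntries-next (k (suc m)) (level a b c′ d (k ∘ inject₁) m)
    (sameEntries-level a b c′ d (k ∘ inject₁) (suc i) m (s≤s z≤n) i≤m
      λ j j≡i → kᵢ≈0 (inject₁ j) (≡.trans (toℕ-inject₁ j) j≡i))

mainTheorem3 : ∀ {c ℓ : Level} (R : CommutativeRing c ℓ) →
    let open CommutativeRing R renaming (Carrier to C) in
    let open Sequences R in
    (a b c' d : C) → a + b ≈ c' + d →
    (n : ℕ) → 1 ≤ n → (k : Fin n → C) →
    (i : Fin n) → 0 < toℕ i → k i ≈ 0# →
    (m : Fin n) → toℕ i ≤ toℕ m →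
    (r : Fin (2 ^ suc (toℕ m))) →
    ∃ λ q → lookup (proj₁ (level a b c' d k m)) r ≈ lookup (proj₂ (level a b c' d k m)) q
mainTheorem3 R a b c' d _ _ _ k i 0<i kᵢ≈0 m i≤m = locate (proj₁ sameEntries)
  where
  open CommutativeRing R
  open EntryInclusion setoid
  open LevelEntries R
  open Sequences R

  sameEntries : SameEntriesPair (level a b c' d k m)
  sameEntries = sameEntries-level a b c' d k (toℕ i) m 0<i i≤m
    λ j j≡i → ≡.subst (λ t → k t ≈ 0#) (toℕ-injective (≡.sym j≡i)) kᵢ≈0
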